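{- Let $\Lambda$ be a non-ordinary acute numerical semigroup with enumeration $\lambda$, conductor $c$, subconductor $c'$ and dominant $d$, and let $m=\min\{\lambda^{ -1}(c+c'-2),\lambda^{ -1}(2d)\}$. For $i\in\mathbb{N}_0$ put $d_{ORD}(C_i)=\min\{\nu_j: j>i\}$. Then $m$ is the smallest integer such that $d_{ORD}(C_i)=\nu_{i+1}$ for all $i\geq m$.
   Context: A numerical semigroup is a subset $\Lambda\subseteq\mathbb{N}_0$ containing $0$, closed under addition, with finite complement in $\mathbb{N}_0$; the conductor $c$ is the smallest integer with $c+\mathbb{N}_0\subseteq\Lambda$; the enumeration is the increasing bijection $\lambda:\mathbb{N}_0\to\Lambda$. $\nu_i=\#\{j\in\mathbb{N}_0:\lambda_i-\lambda_j\in\Lambda\}$. $\Lambda$ is ordinary if $\Lambda=\{0\}\cup\{i\in\mathbb{N}_0:i\geq c\}$. For $\Lambda\neq\mathbb{N}_0$, the dominant $d$ is the largest element of $\Lambda$ smaller than $c$, and the subconductor $c'$ is the smallest element of $\Lambda$ such that every integer in $[c',d]$ lies in $\Lambda$. For non-ordinary $\Lambda$, the subdominant $d'$ is the largest element of $\Lambda$ smaller than $c'$. $\Lambda$ is acute if it is ordinary or it is non-ordinary with $c-d\leq c'-d'$. -}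

module Defs where

open import Level using (0ℓ)
open import Data.Nat using (ℕ; zero; suc; _+_; _*_; _∸_; _≤_; _<_)
open import Data.Bool using (Bool; true; false)
open import Data.Product using (Σ; ∃; _×_; _,_)
open import Data.Sum using (_⊎_)
open import Relation.Nullary using (¬_; Dec; yes; no)
open import Relation.Nullary.Decidable using (⌊_⌋)
open import Relation.Unary using (Pred; Decidable)
open import Relation.Binary.PropositionalEquality using (_≡_)

record NumericalSemigroup : Set₁ where
  field
    _∈Λ      : ℕ → Set
    dec∈Λ    : Decidable _∈Λ
    zero∈Λ   : 0 ∈Λ
    closed   : ∀ {x y} → x ∈Λ → y ∈Λ → (x + y) ∈Λ
    cofinite : Σ ℕ λ N → ∀ n → N ≤ n → n ∈Λ

open NumericalSemigroup public

IsConductor : NumericalSemigroup → ℕ → Set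
IsConductor S c =
  (∀ n → c ≤ n → _∈Λ S n) × (∀ e → (∀ n → e ≤ n → _∈Λ S n) → c ≤ e)

IsDominant : NumericalSemigroup → ℕ → ℕ → Set
IsDominant S c d = _∈Λ S d × d < c × (∀ x → _∈Λ S x → x < c → x ≤ d)

IsSubconductor : NumericalSemigroup → ℕ → ℕ → Set
IsSubconductor S d c' =
  _∈Λ S c' × (∀ n → c' ≤ n → n ≤ d → _∈Λ S n)
  × (∀ x → _∈Λ S x → (∀ n → x ≤ n → n ≤ d → _∈Λ S n) → c' ≤ x)

IsSubdominant : NumericalSemigroup → ℕ → ℕ → Set
IsSubdominant S c' d' = _∈Λ S d' × d' < c' × (∀ x → _∈Λ S x → x < c' → x ≤ d')

IsOrdinary : NumericalSemigroup → ℕ → Set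
IsOrdinary S c = ∀ n → (_∈Λ S n → (n ≡ 0 ⊎ c ≤ n)) × ((n ≡ 0 ⊎ c ≤ n) → _∈Λ S n)

IsEnumeration : NumericalSemigroup → (ℕ → ℕ) → Set
IsEnumeration S lam =
  (∀ i → _∈Λ S (lam i)) × (∀ i j → i < j → lam i < lam j)
  × (∀ x → _∈Λ S x → Σ ℕ λ i → lam i ≡ x)

count : (ℕ → Bool) → ℕ → ℕ
count p zero = zero
count p (suc n) with p n
... | true  = suc (count p n)
... | false = count p n

-- ν_i = #{ j : λ_i - λ_j ∈ Λ }.  Since λ is strictly increasing, only
-- j ≤ i can satisfy λ_i - λ_j ≥ 0, so we count over j ∈ {0,…,i}.
ν : NumericalSemigroup → (ℕ → ℕ) → ℕ → ℕ
ν S lam i = count (λ j → ⌊ dec∈Λ S (lam i ∸ lam j) ⌋) (suc i)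

IsDORD : NumericalSemigroup → (ℕ → ℕ) → ℕ → ℕ → Set
IsDORD S lam i k =
  (Σ ℕ λ j → i < j × ν S lam j ≡ k) × (∀ j → i < j → k ≤ ν S lam j)

module Submission where

-- Write c = 1 + q and c' = 1 + p, so that c + c' - 2 = q + p.  For n ∈ Λ let
-- N n = #{ b ≤ n : b ∈ Λ, n - b ∈ Λ } be the number of representations of n
-- and N⁺ n = #{ b ≤ n : b + 1 ∈ Λ, n - b ∈ Λ }.  Then ν_i = N (λ_i), and when
-- λ_k ≥ c we have λ_{k+1} = λ_k + 1 and ν_{k+1} = 1 + N⁺ (λ_k).  So ν does not
-- decrease at k iff N n ≤ 1 + N⁺ n, and drops at k iff 2 + N⁺ n ≤ N n, for
-- n = λ_k.  The difference N n - N⁺ n is a sum of the termwise differences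
-- χ(n-b)(χ(b) - χ(b+1)); on an initial segment where n - b ≥ c it telescopes,
-- and elsewhere its sign is controlled by the gaps around d, c' and c.
--
-- For acute semigroups four estimates follow: ν does not
-- decrease beyond 2d nor beyond c + c' - 2, and it drops at whichever of these
-- comes first.  The theorem combines them.

open import Defs
open import Data.Nat using (ℕ; zero; suc; _+_; _*_; _∸_; _≤_; _<_; _⊓_; z≤n; s≤s; _≤?_)
open import Data.Nat.Properties
open import Data.Bool using (Bool; true; false)
open import Data.Product using (_×_; _,_; proj₁; proj₂)
open import Data.Sum using (_⊎_; inj₁; inj₂)
open import Data.Empty using (⊥-elim)
open import Relation.Nullary using (¬_; yes; no)
open import Relation.Nullary.Decidable using (⌊_⌋)
open import Relation.Binary.PropositionalEquality
  using (_≡_; refl; sym; trans; cong; cong₂; subst; subst₂; module ≡-Reasoning)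
open import Data.Nat.Tactic.RingSolver using (solve-∀)

indicator : Bool → ℕ
indicator true  = 1
indicator false = 0

sumTo : (ℕ → ℕ) → ℕ → ℕ
sumTo f zero    = 0
sumTo f (suc n) = sumTo f n + f n

sumRange : (ℕ → ℕ) → ℕ → ℕ → ℕ
sumRange f lo hi = sumTo (λ j → f (lo + j)) (hi ∸ lo)

count≡sumTo : ∀ p n → count p n ≡ sumTo (λ k → indicator (p k)) n
count≡sumTo p zero = refl
count≡sumTo p (suc n) with p n
... | true  = trans (cong suc (count≡sumTo p n)) (+-comm 1 _)
... | false = trans (count≡sumTo p n) (sym (+-identityʳ _))

sumTo-cong : ∀ {f g} n → (∀ j → j < n → f j ≡ g j) → sumTo f n ≡ sumTo g n
sumTo-cong zero    eq = refl
sumTo-cong (suc n) eq = cong₂ _+_ (sumTo-cong n (λ j j<n → eq j (m<n⇒m<1+n j<n))) (eq n ≤-refl)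

sumTo-mono : ∀ {f g} n → (∀ j → j < n → f j ≤ g j) → sumTo f n ≤ sumTo g n
sumTo-mono zero    le = z≤n
sumTo-mono (suc n) le = +-mono-≤ (sumTo-mono n (λ j j<n → le j (m<n⇒m<1+n j<n))) (le n ≤-refl)

sumTo-zero : ∀ n → sumTo (λ _ → 0) n ≡ 0
sumTo-zero zero    = refl
sumTo-zero (suc n) = trans (+-identityʳ _) (sumTo-zero n)

sumTo-+ : ∀ f a k → sumTo f (a + k) ≡ sumTo f a + sumTo (λ j → f (a + j)) k
sumTo-+ f a zero    = trans (cong (sumTo f) (+-identityʳ a)) (sym (+-identityʳ _))
sumTo-+ f a (suc k) rewrite +-suc a k | sumTo-+ f a k =
  +-assoc (sumTo f a) (sumTo (λ j → f (a + j)) k) (f (a + k))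

sumTo-split : ∀ f {a n} → a ≤ n → sumTo f n ≡ sumTo f a + sumRange f a n
sumTo-split f {a} {n} a≤n =
  trans (cong (sumTo f) (sym (m+[n∸m]≡n a≤n))) (sumTo-+ f a (n ∸ a))

shift-in-range : ∀ {lo hi j} → lo ≤ hi → j < hi ∸ lo → lo + j < hi
shift-in-range {lo} {hi} {j} lo≤hi j< =
  subst (_≤ hi) (cong suc (+-comm j lo)) (m≤o∸n⇒m+n≤o (suc j) lo≤hi j<)

sumRange-mono : ∀ {f g lo hi} → lo ≤ hi → (∀ b → lo ≤ b → b < hi → f b ≤ g b) →
  sumRange f lo hi ≤ sumRange g lo hi
sumRange-mono {lo = lo} lo≤hi le =
  sumTo-mono _ (λ j j< → le (lo + j) (m≤m+n lo j) (shift-in-range lo≤hi j<))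

sumRange-vanishes : ∀ {f lo hi} → lo ≤ hi → (∀ b → lo ≤ b → b < hi → f b ≡ 0) →
  sumRange f lo hi ≡ 0
sumRange-vanishes {lo = lo} {hi} lo≤hi zero-on = n≤0⇒n≡0
  (≤-trans (sumRange-mono lo≤hi (λ b l u → ≤-reflexive (zero-on b l u)))
           (≤-reflexive (sumTo-zero (hi ∸ lo))))

sumTo-around : ∀ f {lo d n} → lo ≤ d → d ≤ n →
  sumTo f (suc n) ≡ sumTo f lo + (sumRange f lo d + (f d + sumRange f (suc d) (suc n)))
sumTo-around f {lo} {d} {n} lo≤d d≤n = begin
  sumTo f (suc n)                ≡⟨ sumTo-split f (s≤s d≤n) ⟩
  (sumTo f d + f d) + T          ≡⟨ cong (λ s → (s + f d) + T) (sumTo-split f lo≤d) ⟩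
  ((sumTo f lo + M) + f d) + T   ≡⟨ +-assoc (sumTo f lo + M) (f d) T ⟩
  (sumTo f lo + M) + (f d + T)   ≡⟨ +-assoc (sumTo f lo) M (f d + T) ⟩
  sumTo f lo + (M + (f d + T))   ∎
  where
  open ≡-Reasoning
  M = sumRange f lo d
  T = sumRange f (suc d) (suc n)

sumTo-telescope : ∀ f k → sumTo (λ j → f (suc j)) k + f 0 ≡ sumTo f k + f k
sumTo-telescope f zero    = refl
sumTo-telescope f (suc k) = begin
  (S⁺ + f (suc k)) + f 0  ≡⟨ +-assoc S⁺ (f (suc k)) (f 0) ⟩
  S⁺ + (f (suc k) + f 0)  ≡⟨ cong (S⁺ +_) (+-comm (f (suc k)) (f 0)) ⟩
  S⁺ + (f 0 + f (suc k))  ≡⟨ sym (+-assoc S⁺ (f 0) (f (suc k))) ⟩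
  (S⁺ + f 0) + f (suc k)  ≡⟨ cong (_+ f (suc k)) (sumTo-telescope f k) ⟩
  (sumTo f k + f k) + f (suc k) ∎
  where
  open ≡-Reasoning
  S⁺ = sumTo (λ j → f (suc j)) k

regroup-ascent : ∀ a b e t → a + (b + ((1 + e) + t)) ≡ 1 + (a + (b + (e + t)))
regroup-ascent = solve-∀

regroup-descent : ∀ a b e t → (1 + a) + (b + ((1 + e) + t)) ≡ 2 + (a + (b + (e + t)))
regroup-descent = solve-∀

around-ascent : ∀ f g {lo d n} → lo ≤ d → d ≤ n →
  sumTo f lo ≤ sumTo g lo → sumRange f lo d ≤ sumRange g lo d → f d ≤ 1 + g d →
  sumRange f (suc d) (suc n) ≤ sumRange g (suc d) (suc n) →
  sumTo f (suc n) ≤ 1 + sumTo g (suc n)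
around-ascent f g {lo} {d} {n} lo≤d d≤n low middle point tail = begin
  sumTo f (suc n)
    ≡⟨ sumTo-around f lo≤d d≤n ⟩
  sumTo f lo + (M f + (f d + T f))
    ≤⟨ +-mono-≤ low (+-mono-≤ middle (+-mono-≤ point tail)) ⟩
  sumTo g lo + (M g + ((1 + g d) + T g))
    ≡⟨ regroup-ascent (sumTo g lo) (M g) (g d) (T g) ⟩
  1 + (sumTo g lo + (M g + (g d + T g)))
    ≡⟨ cong (1 +_) (sym (sumTo-around g lo≤d d≤n)) ⟩
  1 + sumTo g (suc n) ∎
  where
  open ≤-Reasoning
  M T : (ℕ → ℕ) → ℕ
  M h = sumRange h lo d
  T h = sumRange h (suc d) (suc n)

around-descent : ∀ f g {lo d n} → lo ≤ d → d ≤ n →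
  1 + sumTo g lo ≤ sumTo f lo → sumRange g lo d ≤ sumRange f lo d → 1 + g d ≤ f d →
  sumRange g (suc d) (suc n) ≤ sumRange f (suc d) (suc n) →
  2 + sumTo g (suc n) ≤ sumTo f (suc n)
around-descent f g {lo} {d} {n} lo≤d d≤n low middle point tail = begin
  2 + sumTo g (suc n)
    ≡⟨ cong (2 +_) (sumTo-around g lo≤d d≤n) ⟩
  2 + (sumTo g lo + (M g + (g d + T g)))
    ≡⟨ sym (regroup-descent (sumTo g lo) (M g) (g d) (T g)) ⟩
  (1 + sumTo g lo) + (M g + ((1 + g d) + T g))
    ≤⟨ +-mono-≤ low (+-mono-≤ middle (+-mono-≤ point tail)) ⟩
  sumTo f lo + (M f + (f d + T f))
    ≡⟨ sym (sumTo-around f lo≤d d≤n) ⟩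
  sumTo f (suc n) ∎
  where
  open ≤-Reasoning
  M T : (ℕ → ℕ) → ℕ
  M h = sumRange h lo d
  T h = sumRange h (suc d) (suc n)

module Representations (S : NumericalSemigroup) where

  inΛ : ℕ → Set
  inΛ = _∈Λ S

  χ : ℕ → ℕ
  χ x = indicator ⌊ dec∈Λ S x ⌋

  χ-in : ∀ {x} → inΛ x → χ x ≡ 1
  χ-in {x} x∈ with dec∈Λ S x
  ... | yes _ = refl
  ... | no x∉ = ⊥-elim (x∉ x∈)

  χ-out : ∀ {x} → ¬ inΛ x → χ x ≡ 0
  χ-out {x} x∉ with dec∈Λ S x
  ... | yes x∈ = ⊥-elim (x∉ x∈)
  ... | no _   = refl

  χ≤1 : ∀ x → χ x ≤ 1
  χ≤1 x with dec∈Λ S x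
  ... | yes _ = ≤-refl
  ... | no _  = z≤n

  χ-mono : ∀ {a a'} → (inΛ a → inΛ a') → χ a ≤ χ a'
  χ-mono {a} {a'} a→a' with dec∈Λ S a
  ... | no _   = z≤n
  ... | yes a∈ = ≤-reflexive (sym (χ-in (a→a' a∈)))

  X : ℕ → ℕ → ℕ
  X n b = χ b * χ (n ∸ b)

  Y : ℕ → ℕ → ℕ
  Y n b = χ (suc b) * χ (n ∸ b)

  N : ℕ → ℕ
  N n = sumTo (X n) (suc n)

  -- N⁺ n = number of such representations of n + 1 with positive first summand.
  N⁺ : ℕ → ℕ
  N⁺ n = sumTo (Y n) (suc n)

  -- The representations of n + 1 are 0 + (n + 1) and those counted by N⁺ n.
  N-suc : ∀ n → inΛ (suc n) → N (suc n) ≡ 1 + N⁺ n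
  N-suc n n+1∈ = sumTo-shift (suc n)
    where
    first : X (suc n) 0 ≡ 1
    first rewrite χ-in (zero∈Λ S) | χ-in n+1∈ = refl
    sumTo-shift : ∀ k → sumTo (X (suc n)) (suc k) ≡ 1 + sumTo (Y n) k
    sumTo-shift zero    = first
    sumTo-shift (suc k) = cong (_+ Y n k) (sumTo-shift k)

  weighted-mono : ∀ {a a' e} → (inΛ e → inΛ a → inΛ a') → χ a * χ e ≤ χ a' * χ e
  weighted-mono {a} {a'} {e} cond with dec∈Λ S e
  ... | yes e∈ = *-monoˡ-≤ _ (χ-mono (cond e∈))
  ... | no _   = ≤-reflexive (trans (*-zeroʳ (χ a)) (sym (*-zeroʳ (χ a'))))

  X≤Y : ∀ n b → (inΛ (n ∸ b) → inΛ b → inΛ (suc b)) → X n b ≤ Y n b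
  X≤Y n b = weighted-mono

  Y≤X : ∀ n b → (inΛ (n ∸ b) → inΛ (suc b) → inΛ b) → Y n b ≤ X n b
  Y≤X n b = weighted-mono

  X≤1 : ∀ n b → X n b ≤ 1
  X≤1 n b = *-mono-≤ (χ≤1 b) (χ≤1 (n ∸ b))

  end-of-block : ∀ n b → inΛ b → ¬ inΛ (suc b) → inΛ (n ∸ b) → 1 + Y n b ≡ X n b
  end-of-block n b b∈ b+1∉ n-b∈ rewrite χ-in b∈ | χ-out b+1∉ | χ-in n-b∈ = refl

  telescope : ∀ n u → (∀ b → b < u → inΛ (n ∸ b)) →
    sumTo (X n) u + χ u ≡ sumTo (Y n) u + 1
  telescope n u full = begin
    sumTo (X n) u + χ u               ≡⟨ cong (_+ χ u) (sumTo-cong u X≡χ) ⟩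
    sumTo χ u + χ u                   ≡⟨ sym (sumTo-telescope χ u) ⟩
    sumTo (λ b → χ (suc b)) u + χ 0
      ≡⟨ cong₂ _+_ (sym (sumTo-cong u Y≡χ⁺)) (χ-in (zero∈Λ S)) ⟩
    sumTo (Y n) u + 1                 ∎
    where
    open ≡-Reasoning
    X≡χ : ∀ b → b < u → X n b ≡ χ b
    X≡χ b b<u rewrite χ-in (full b b<u) = *-identityʳ (χ b)
    Y≡χ⁺ : ∀ b → b < u → Y n b ≡ χ (suc b)
    Y≡χ⁺ b b<u rewrite χ-in (full b b<u) = *-identityʳ (χ (suc b))

module Enumeration (S : NumericalSemigroup) (lam : ℕ → ℕ) (en : IsEnumeration S lam) where
  open Representations S

  mono : ∀ {i j} → i < j → lam i < lam j
  mono {i} {j} = proj₁ (proj₂ en) i j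

  mono≤ : ∀ {i j} → i ≤ j → lam i ≤ lam j
  mono≤ i≤j with m≤n⇒m<n∨m≡n i≤j
  ... | inj₁ i<j  = <⇒≤ (mono i<j)
  ... | inj₂ refl = ≤-refl

  reflect< : ∀ {i j} → lam i < lam j → i < j
  reflect< {i} {j} lt = ≰⇒> (λ j≤i → <⇒≱ lt (mono≤ j≤i))

  lam-zero : lam 0 ≡ 0
  lam-zero with proj₂ (proj₂ en) 0 (zero∈Λ S)
  ... | k , lam-k≡0 = n≤0⇒n≡0 (subst (lam 0 ≤_) lam-k≡0 (mono≤ z≤n))

  between-gap : ∀ i b → lam i < b → b < lam (suc i) → ¬ inΛ b
  between-gap i b lo hi b∈ with proj₂ (proj₂ en) b b∈
  ... | j , refl = <⇒≱ (reflect< lo) (≤-pred (reflect< hi))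

  sum-over-Λ : ∀ (g : ℕ → ℕ) i →
    sumTo (λ j → g (lam j)) (suc i) ≡ sumTo (λ b → χ b * g b) (suc (lam i))
  sum-over-Λ g zero rewrite lam-zero | χ-in (zero∈Λ S) = cong (0 +_) (sym (+-identityʳ (g 0)))
  sum-over-Λ g (suc i) = begin
    sumTo (λ j → g (lam j)) (suc i) + g L ≡⟨ cong (_+ g L) (sum-over-Λ g i) ⟩
    H + g L                               ≡⟨ cong₂ _+_ (sym (+-identityʳ H)) (sym h-at-L) ⟩
    H + 0 + h L                           ≡⟨ cong (λ z → H + z + h L) (sym no-terms-between) ⟩
    H + sumRange h (suc (lam i)) L + h L  ≡⟨ cong (_+ h L) (sym (sumTo-split h λi<L)) ⟩
    sumTo h L + h L                       ∎
    where
    open ≡-Reasoning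
    h : ℕ → ℕ
    h b = χ b * g b
    L = lam (suc i)
    H = sumTo h (suc (lam i))
    λi<L : suc (lam i) ≤ L
    λi<L = mono ≤-refl
    h-at-L : h L ≡ g L
    h-at-L rewrite χ-in (proj₁ en (suc i)) = +-identityʳ (g L)
    no-terms-between : sumRange h (suc (lam i)) L ≡ 0
    no-terms-between = sumRange-vanishes λi<L
      (λ b lo hi → cong (_* g b) (χ-out (between-gap i b lo hi)))

  ν≡N : ∀ i → ν S lam i ≡ N (lam i)
  ν≡N i = trans (count≡sumTo _ (suc i)) (sum-over-Λ (λ b → χ (lam i ∸ b)) i)

  next : ∀ k → inΛ (suc (lam k)) → lam (suc k) ≡ suc (lam k)
  next k λk+1∈ with proj₂ (proj₂ en) (suc (lam k)) λk+1∈
  ... | j , lam-j≡ = ≤-antisym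
    (subst (lam (suc k) ≤_) lam-j≡ (mono≤ (reflect< (subst (lam k <_) (sym lam-j≡) ≤-refl))))
    (mono ≤-refl)

  ν-suc : ∀ k → inΛ (suc (lam k)) → ν S lam (suc k) ≡ 1 + N⁺ (lam k)
  ν-suc k λk+1∈ = trans (ν≡N (suc k)) (trans (cong N (next k λk+1∈)) (N-suc (lam k) λk+1∈))

StableFrom : NumericalSemigroup → (ℕ → ℕ) → ℕ → Set
StableFrom S lam m = ∀ i → m ≤ i → IsDORD S lam i (ν S lam (1 + i))

LeastStable : NumericalSemigroup → (ℕ → ℕ) → ℕ → Set
LeastStable S lam m = StableFrom S lam m × (∀ m' → StableFrom S lam m' → m ≤ m')

least-stable : ∀ S lam M → (∀ k → M < k → ν S lam k ≤ ν S lam (suc k)) →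
  ν S lam (suc M) < ν S lam M → LeastStable S lam M
least-stable S lam M step drop = stable , least
  where
  climb : ∀ k t → M < k → ν S lam k ≤ ν S lam (t + k)
  climb k zero    M<k = ≤-refl
  climb k (suc t) M<k = ≤-trans (climb k t M<k) (step (t + k) (≤-trans M<k (m≤n+m k t)))

  stable : StableFrom S lam M
  stable i M≤i = (suc i , ≤-refl , refl) , λ j i<j →
    subst (λ z → ν S lam (suc i) ≤ ν S lam z) (m∸n+n≡m i<j)
      (climb (suc i) (j ∸ suc i) (s≤s M≤i))

  -- A stable index m < M would force ν_M ≤ ν_{M+1}.
  not-before : ∀ {m} K → StableFrom S lam m → ν S lam (suc K) < ν S lam K → ¬ m < K
  not-before (suc k) from dropK (s≤s m≤k) =
    <⇒≱ dropK (proj₂ (from k m≤k) (suc (suc k)) (n≤1+n (suc k)))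

  least : ∀ m' → StableFrom S lam m' → M ≤ m'
  least m' from = ≮⇒≥ (not-before M from drop)

module AboveConductor (S : NumericalSemigroup) (lam : ℕ → ℕ) (en : IsEnumeration S lam)
  (q : ℕ) (conductor : ∀ n → suc q ≤ n → _∈Λ S n) where
  open Representations S
  open Enumeration S lam en

  -- Every λ_k ≥ c is followed by λ_k + 1.
  ν-after : ∀ k → suc q ≤ lam k → ν S lam (suc k) ≡ 1 + N⁺ (lam k)
  ν-after k c≤λk = ν-suc k (conductor _ (≤-trans c≤λk (n≤1+n _)))

  least-stable-above : ∀ M t → lam M ≡ t → suc q ≤ t →
    (∀ n → t < n → N n ≤ 1 + N⁺ n) → 2 + N⁺ t ≤ N t → LeastStable S lam M
  least-stable-above M _ refl c≤λM ascent descent = least-stable S lam M step drop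
    where
    step : ∀ k → M < k → ν S lam k ≤ ν S lam (suc k)
    step k M<k = subst₂ _≤_ (sym (ν≡N k)) (sym (ν-after k c≤λk)) (ascent (lam k) (mono M<k))
      where
      c≤λk : suc q ≤ lam k
      c≤λk = ≤-trans c≤λM (<⇒≤ (mono M<k))
    drop : ν S lam (suc M) < ν S lam M
    drop = subst₂ _<_ (sym (ν-after M c≤λM)) (sym (ν≡N M)) descent

module Acute (S : NumericalSemigroup) (q d p d' : ℕ)
  (isC : IsConductor S (suc q))
  (nonord : ¬ IsOrdinary S (suc q))
  (dom : IsDominant S (suc q) d)
  (sub : IsSubconductor S d (suc p))
  (subd : IsSubdominant S (suc p) d')
  (acute : suc q ∸ d ≤ suc p ∸ d') where

  open Representations S

  conductor : ∀ n → suc q ≤ n → inΛ n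
  conductor = proj₁ isC

  d∈ : inΛ d
  d∈ = proj₁ dom

  below-dominant : ∀ x → inΛ x → x < suc q → x ≤ d
  below-dominant = proj₂ (proj₂ dom)

  above-dominant : ∀ x → inΛ x → d < x → suc q ≤ x
  above-dominant x x∈ d<x = ≮⇒≥ (λ x<c → <⇒≱ d<x (below-dominant x x∈ x<c))

  between-d-and-c : ∀ x → d < x → x < suc q → ¬ inΛ x
  between-d-and-c x d<x x<c x∈ = <⇒≱ d<x (below-dominant x x∈ x<c)

  succ-above-d : ∀ {b} → d < b → inΛ b → inΛ (suc b)
  succ-above-d d<b b∈ = conductor _ (≤-trans (above-dominant _ b∈ d<b) (n≤1+n _))

  c-1-gap : ¬ inΛ q
  c-1-gap q∈ = <-irrefl refl (proj₂ isC q from-q)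
    where
    from-q : ∀ n → q ≤ n → inΛ n
    from-q n q≤n with m≤n⇒m<n∨m≡n q≤n
    ... | inj₁ q<n  = conductor n q<n
    ... | inj₂ refl = q∈

  d<q : d < q
  d<q = ≤∧≢⇒< (≤-pred (proj₁ (proj₂ dom))) (λ d≡q → c-1-gap (subst inΛ d≡q d∈))

  d+1-gap : ¬ inΛ (suc d)
  d+1-gap = between-d-and-c (suc d) ≤-refl (s≤s d<q)

  d-positive : 0 < d
  d-positive = ≰⇒> (λ d≤0 → nonord (λ n → classify n d≤0 , from-class n))
    where
    classify : ∀ n → d ≤ 0 → inΛ n → n ≡ 0 ⊎ suc q ≤ n
    classify n d≤0 n∈ with suc q ≤? n
    ... | yes c≤n = inj₂ c≤n
    ... | no c≰n  = inj₁ (n≤0⇒n≡0 (≤-trans (below-dominant n n∈ (≰⇒> c≰n)) d≤0))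
    from-class : ∀ n → n ≡ 0 ⊎ suc q ≤ n → inΛ n
    from-class n (inj₁ refl) = zero∈Λ S
    from-class n (inj₂ c≤n)  = conductor n c≤n

  c≤2d : suc q ≤ d + d
  c≤2d = above-dominant (d + d) (closed S d∈ d∈)
    (subst (_≤ d + d) (+-comm d 1) (+-monoʳ-≤ d d-positive))

  interval : ∀ n → suc p ≤ n → n ≤ d → inΛ n
  interval = proj₁ (proj₂ sub)

  c'∈ : inΛ (suc p)
  c'∈ = proj₁ sub

  c'≤d : suc p ≤ d
  c'≤d = proj₂ (proj₂ sub) d d∈ (λ n d≤n n≤d → subst inΛ (≤-antisym d≤n n≤d) d∈)

  c'-1-gap : ¬ inΛ p
  c'-1-gap p∈ = <-irrefl refl (proj₂ (proj₂ sub) p p∈ from-p)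
    where
    from-p : ∀ n → p ≤ n → n ≤ d → inΛ n
    from-p n p≤n n≤d with m≤n⇒m<n∨m≡n p≤n
    ... | inj₁ p<n  = interval n p<n n≤d
    ... | inj₂ refl = p∈

  c≤c+c'-2 : suc q ≤ q + p
  c≤c+c'-2 = subst (_≤ q + p) (+-comm q 1) (+-monoʳ-≤ q p-positive)
    where
    p-positive : 1 ≤ p
    p-positive = ≰⇒> (λ p≤0 → c'-1-gap (subst inΛ (sym (n≤0⇒n≡0 p≤0)) (zero∈Λ S)))

  acute-bound : suc q + d' ≤ d + d
  acute-bound = begin
    suc q + d'                ≡⟨ cong (_+ d') (sym (m∸n+n≡m d≤c)) ⟩
    (suc q ∸ d) + d + d'      ≤⟨ +-monoˡ-≤ d' (+-monoˡ-≤ d acute) ⟩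
    (suc p ∸ d') + d + d'     ≡⟨ +-assoc (suc p ∸ d') d d' ⟩
    (suc p ∸ d') + (d + d')   ≡⟨ cong ((suc p ∸ d') +_) (+-comm d d') ⟩
    (suc p ∸ d') + (d' + d)   ≡⟨ sym (+-assoc (suc p ∸ d') d' d) ⟩
    (suc p ∸ d') + d' + d     ≡⟨ cong (_+ d) (m∸n+n≡m (<⇒≤ (proj₁ (proj₂ subd)))) ⟩
    suc p + d                 ≤⟨ +-monoˡ-≤ d c'≤d ⟩
    d + d                     ∎
    where
    open ≤-Reasoning
    d≤c : d ≤ suc q
    d≤c = ≤-trans (<⇒≤ d<q) (n≤1+n q)

  -- If u + q ≤ n then n - b ≥ c for every b < u, so the first u terms telescope.
  low-telescope : ∀ n u → u + q ≤ n → sumTo (X n) u + χ u ≡ sumTo (Y n) u + 1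
  low-telescope n u u+q≤n =
    telescope n u (λ b b<u → conductor _ (m+n≤o⇒m≤o∸n (suc q) (c+b≤n b b<u)))
    where
    c+b≤n : ∀ b → b < u → suc q + b ≤ n
    c+b≤n b b<u = subst (_≤ n) (cong suc (+-comm b q)) (≤-trans (+-monoˡ-≤ q b<u) u+q≤n)

  low-bound : ∀ n u → u + q ≤ n → sumTo (X n) u ≤ 1 + sumTo (Y n) u
  low-bound n u u+q≤n = begin
    sumTo (X n) u             ≤⟨ m≤m+n _ (χ u) ⟩
    sumTo (X n) u + χ u       ≡⟨ low-telescope n u u+q≤n ⟩
    sumTo (Y n) u + 1         ≡⟨ +-comm _ 1 ⟩
    1 + sumTo (Y n) u         ∎
    where open ≤-Reasoning

  low-at-element : ∀ n u → u + q ≤ n → inΛ u → sumTo (X n) u ≡ sumTo (Y n) u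
  low-at-element n u u+q≤n u∈ =
    +-cancelʳ-≡ 1 _ _ (trans (cong (sumTo (X n) u +_) (sym (χ-in u∈))) (low-telescope n u u+q≤n))

  low-at-gap : ∀ n u → u + q ≤ n → ¬ inΛ u → sumTo (X n) u ≡ 1 + sumTo (Y n) u
  low-at-gap n u u+q≤n u∉ = begin
    sumTo (X n) u             ≡⟨ sym (+-identityʳ _) ⟩
    sumTo (X n) u + 0         ≡⟨ cong (sumTo (X n) u +_) (sym (χ-out u∉)) ⟩
    sumTo (X n) u + χ u       ≡⟨ low-telescope n u u+q≤n ⟩
    sumTo (Y n) u + 1         ≡⟨ +-comm _ 1 ⟩
    1 + sumTo (Y n) u         ∎
    where open ≡-Reasoning

  tail-ascends : ∀ n b → d < b → X n b ≤ Y n b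
  tail-ascends n b d<b = X≤Y n b (λ _ → succ-above-d d<b)

  -- Past the dominant, Y ≤ X termwise provided n - (c - 1) is a gap: the only
  -- b > d with b + 1 ∈ Λ but b ∉ Λ is b = c - 1.
  tail-descends : ∀ n → ¬ inΛ (n ∸ q) → ∀ b → d < b → Y n b ≤ X n b
  tail-descends n n-q∉ b d<b = Y≤X n b b+1→b
    where
    b+1→b : inΛ (n ∸ b) → inΛ (suc b) → inΛ b
    b+1→b n-b∈ b+1∈ with m≤n⇒m<n∨m≡n (above-dominant (suc b) b+1∈ (m<n⇒m<1+n d<b))
    ... | inj₁ c<b+1 = conductor b (≤-pred c<b+1)
    ... | inj₂ refl  = ⊥-elim (n-q∉ n-b∈)

  complement-below-c : ∀ n b → q ≤ n → n ∸ q ≤ b → n ∸ b ≤ q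
  complement-below-c n b q≤n n-q≤b =
    subst (n ∸ b ≤_) (m∸[m∸n]≡n q≤n) (∸-monoʳ-≤ n n-q≤b)

  -- ν does not decrease beyond 2d: split at u = n - q; below u telescope, above u
  -- every representation n = b + (n - b) has n - b ≤ d, hence b > d.
  ascent-past-2d : ∀ n → d + d < n → N n ≤ 1 + N⁺ n
  ascent-past-2d n 2d<n = begin
    N n
      ≡⟨ sumTo-split (X n) u≤n+1 ⟩
    sumTo (X n) u + sumRange (X n) u (suc n)
      ≤⟨ +-mono-≤ (low-bound n u (≤-reflexive u+q≡n)) (sumRange-mono u≤n+1 high) ⟩
    (1 + sumTo (Y n) u) + sumRange (Y n) u (suc n)
      ≡⟨ cong (1 +_) (sym (sumTo-split (Y n) u≤n+1)) ⟩
    1 + N⁺ n ∎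
    where
    open ≤-Reasoning
    q≤n : q ≤ n
    q≤n = ≤-trans (≤-trans (n≤1+n q) c≤2d) (<⇒≤ 2d<n)
    u = n ∸ q
    u+q≡n : u + q ≡ n
    u+q≡n = m∸n+n≡m q≤n
    u≤n+1 : u ≤ suc n
    u≤n+1 = ≤-trans (m∸n≤m n q) (n≤1+n n)
    high : ∀ b → u ≤ b → b < suc n → X n b ≤ Y n b
    high b u≤b b≤n = X≤Y n b b→b+1
      where
      b→b+1 : inΛ (n ∸ b) → inΛ b → inΛ (suc b)
      b→b+1 n-b∈ = succ-above-d (+-cancelˡ-< d d b (<-≤-trans 2d<n n≤d+b))
        where
        n-b≤d : n ∸ b ≤ d
        n-b≤d = below-dominant _ n-b∈ (s≤s (complement-below-c n b q≤n u≤b))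
        n≤d+b : n ≤ d + b
        n≤d+b = subst (_≤ d + b) (m∸n+n≡m (≤-pred b≤n)) (+-monoˡ-≤ b n-b≤d)

  -- ν does not decrease beyond c + c' - 2: [0, c') telescopes exactly, on [c', d)
  -- b + 1 ∈ [c', d] ⊆ Λ, the term at d contributes at most 1, and past d X ≤ Y.
  ascent-past-cc' : ∀ n → q + p < n → N n ≤ 1 + N⁺ n
  ascent-past-cc' n q+p<n = around-ascent (X n) (Y n) c'≤d d≤n (≤-reflexive low) middle point tail
    where
    d≤n : d ≤ n
    d≤n = ≤-trans (<⇒≤ d<q) (≤-trans (m≤m+n q p) (<⇒≤ q+p<n))
    low : sumTo (X n) (suc p) ≡ sumTo (Y n) (suc p)
    low = low-at-element n (suc p) (subst (_≤ n) (cong suc (+-comm q p)) q+p<n) c'∈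
    middle : sumRange (X n) (suc p) d ≤ sumRange (Y n) (suc p) d
    middle = sumRange-mono c'≤d (λ b c'≤b b<d →
      X≤Y n b (λ _ _ → interval (suc b) (≤-trans c'≤b (n≤1+n b)) b<d))
    point : X n d ≤ 1 + Y n d
    point = ≤-trans (X≤1 n d) (m≤m+n 1 _)
    tail : sumRange (X n) (suc d) (suc n) ≤ sumRange (Y n) (suc d) (suc n)
    tail = sumRange-mono (s≤s d≤n) (λ b d<b _ → tail-ascends n b d<b)

  -- ν drops at c + c' - 2 when c + c' - 2 ≤ 2d: [0, c' - 1) telescopes onto the gap
  -- c' - 1, on [c' - 1, d) Y ≤ X, d is the end of a block with n - d ∈ [c', d],
  -- and past d Y ≤ X since n - (c - 1) = c' - 1 is a gap.
  descent-at-cc' : q + p ≤ d + d → 2 + N⁺ (q + p) ≤ N (q + p)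
  descent-at-cc' n≤2d =
    around-descent (X n) (Y n) p≤d d≤n (≤-reflexive (sym low)) middle (≤-reflexive point) tail
    where
    n = q + p
    p≤d : p ≤ d
    p≤d = ≤-trans (n≤1+n p) c'≤d
    d≤n : d ≤ n
    d≤n = ≤-trans (<⇒≤ d<q) (m≤m+n q p)
    low : sumTo (X n) p ≡ 1 + sumTo (Y n) p
    low = low-at-gap n p (≤-reflexive (+-comm p q)) c'-1-gap
    middle : sumRange (Y n) p d ≤ sumRange (X n) p d
    middle = sumRange-mono p≤d (λ b p≤b b<d → Y≤X n b (b+1→b b p≤b b<d))
      where
      b+1→b : ∀ b → p ≤ b → b < d → inΛ (n ∸ b) → inΛ (suc b) → inΛ b
      b+1→b b p≤b b<d n-b∈ _ with m≤n⇒m<n∨m≡n p≤b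
      ... | inj₁ p<b  = interval b p<b (<⇒≤ b<d)
      ... | inj₂ refl = ⊥-elim (c-1-gap (subst inΛ (m+n∸n≡m q p) n-b∈))
    point : 1 + Y n d ≡ X n d
    point = end-of-block n d d∈ d+1-gap (interval (n ∸ d) c'≤n-d n-d≤d)
      where
      c'≤n-d : suc p ≤ n ∸ d
      c'≤n-d = m+n≤o⇒m≤o∸n (suc p) (subst (_≤ n) (+-comm d (suc p)) d+c'≤n)
        where
        d+c'≤n : d + suc p ≤ n
        d+c'≤n = subst (_≤ n) (sym (+-suc d p)) (+-monoˡ-≤ p d<q)
      n-d≤d : n ∸ d ≤ d
      n-d≤d = subst (n ∸ d ≤_) (m+n∸m≡n d d) (∸-monoˡ-≤ d n≤2d)
    tail : sumRange (Y n) (suc d) (suc n) ≤ sumRange (X n) (suc d) (suc n)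
    tail = sumRange-mono (s≤s d≤n)
      (λ b d<b _ → tail-descends n n-q∉ b d<b)
      where
      n-q∉ : ¬ inΛ (n ∸ q)
      n-q∉ = subst (λ z → ¬ inΛ z) (sym (m+n∸m≡n q p)) c'-1-gap

  -- ν drops at 2d when 2d < c + c' - 2: with u = 2d - (c - 1), acuteness gives
  -- d' < u < c', so [0, u) telescopes onto a gap; on [u, d) each 2d - b lies
  -- strictly between d and c; d ends a block with 2d - d = d ∈ Λ; past d Y ≤ X
  -- since 2d - (c - 1) = u is a gap.
  descent-at-2d : d + d < q + p → 2 + N⁺ (d + d) ≤ N (d + d)
  descent-at-2d n<q+p =
    around-descent (X n) (Y n) u≤d d≤n (≤-reflexive (sym low)) middle (≤-reflexive point) tail
    where
    n = d + d
    q≤n : q ≤ n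
    q≤n = ≤-trans (n≤1+n q) c≤2d
    d≤n : d ≤ n
    d≤n = m≤m+n d d
    u = n ∸ q
    u+q≡n : u + q ≡ n
    u+q≡n = m∸n+n≡m q≤n
    u≤d : u ≤ d
    u≤d = +-cancelʳ-≤ q u d (subst (_≤ d + q) (sym u+q≡n) (+-monoʳ-≤ d (<⇒≤ d<q)))
    u-gap : ¬ inΛ u
    u-gap u∈ = <⇒≱ d'<u (proj₂ (proj₂ subd) u u∈ (s≤s u≤p))
      where
      d'<u : d' < u
      d'<u = +-cancelʳ-≤ q (suc d') u (subst (suc d' + q ≤_) (sym u+q≡n)
               (subst (_≤ n) (cong suc (+-comm q d')) acute-bound))
      u≤p : u ≤ p
      u≤p = <⇒≤ (+-cancelʳ-< q u p (subst₂ _<_ (sym u+q≡n) (+-comm q p) n<q+p))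
    low : sumTo (X n) u ≡ 1 + sumTo (Y n) u
    low = low-at-gap n u (≤-reflexive u+q≡n) u-gap
    middle : sumRange (Y n) u d ≤ sumRange (X n) u d
    middle = sumRange-mono u≤d (λ b u≤b b<d →
      Y≤X n b (λ n-b∈ → ⊥-elim (complement-gap b u≤b b<d n-b∈)))
      where
      complement-gap : ∀ b → u ≤ b → b < d → ¬ inΛ (n ∸ b)
      complement-gap b u≤b b<d = between-d-and-c (n ∸ b)
        (m+n≤o⇒m≤o∸n (suc d) (subst (_≤ n) (cong suc (+-comm b d)) (+-monoˡ-≤ d b<d)))
        (s≤s (complement-below-c n b q≤n u≤b))
    point : 1 + Y n d ≡ X n d
    point = end-of-block n d d∈ d+1-gap (subst inΛ (sym (m+n∸m≡n d d)) d∈)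
    tail : sumRange (Y n) (suc d) (suc n) ≤ sumRange (X n) (suc d) (suc n)
    tail = sumRange-mono (s≤s d≤n) (λ b d<b _ → tail-descends n u-gap b d<b)

  module Threshold (lam : ℕ → ℕ) (en : IsEnumeration S lam) (i₁ i₂ : ℕ)
    (λi₁ : lam i₁ ≡ q + p) (λi₂ : lam i₂ ≡ d + d) where
    open Enumeration S lam en using (mono; mono≤)
    open AboveConductor S lam en q conductor

    threshold-cc' : i₁ ≤ i₂ → LeastStable S lam i₁
    threshold-cc' i₁≤i₂ = least-stable-above i₁ (q + p) λi₁ c≤c+c'-2 ascent-past-cc'
      (descent-at-cc' (subst₂ _≤_ λi₁ λi₂ (mono≤ i₁≤i₂)))

    threshold-2d : i₂ < i₁ → LeastStable S lam i₂
    threshold-2d i₂<i₁ = least-stable-above i₂ (d + d) λi₂ c≤2d ascent-past-2d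
      (descent-at-2d (subst₂ _<_ λi₂ λi₁ (mono i₂<i₁)))

    least-stable-at-min : LeastStable S lam (i₁ ⊓ i₂)
    least-stable-at-min with i₁ ≤? i₂
    ... | yes i₁≤i₂ rewrite m≤n⇒m⊓n≡m i₁≤i₂ = threshold-cc' i₁≤i₂
    ... | no i₁≰i₂  rewrite m≥n⇒m⊓n≡n (<⇒≤ (≰⇒> i₁≰i₂)) = threshold-2d (≰⇒> i₁≰i₂)

mainTheorem12 : (S : NumericalSemigroup) (lam : ℕ → ℕ) (c d c' d' : ℕ)
    → IsEnumeration S lam
    → IsConductor S c
    → ¬ IsOrdinary S c
    → IsDominant S c d
    → IsSubconductor S d c'
    → IsSubdominant S c' d'
    → c ∸ d ≤ c' ∸ d'
    → (i₁ i₂ : ℕ) → lam i₁ ≡ c + c' ∸ 2 → lam i₂ ≡ 2 * d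
    → (∀ i → i₁ ⊓ i₂ ≤ i → IsDORD S lam i (ν S lam (1 + i)))
    × (∀ m → (∀ i → m ≤ i → IsDORD S lam i (ν S lam (1 + i))) → i₁ ⊓ i₂ ≤ m)
-- c = 0 and c' = 0 are impossible, since d < c and d' < c'.
mainTheorem12 S lam zero d c' d' en isC nonord (_ , () , _) sub subd acute i₁ i₂ e₁ e₂
mainTheorem12 S lam (suc q) d zero d' en isC nonord dom sub (_ , () , _) acute i₁ i₂ e₁ e₂
mainTheorem12 S lam (suc q) d (suc p) d' en isC nonord dom sub subd acute i₁ i₂ e₁ e₂ =
  Threshold.least-stable-at-min lam en i₁ i₂ λi₁ λi₂
  where
  open Acute S q d p d' isC nonord dom sub subd acute
  λi₁ : lam i₁ ≡ q + p
  λi₁ = trans e₁ (cong (_∸ 1) (+-suc q p))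
  λi₂ : lam i₂ ≡ d + d
  λi₂ = trans e₂ (cong (d +_) (+-identityʳ d))
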